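{- The sparing number of the fan graph $F_{1,n}=P_n+K_1$ is $\varphi(F_{1,n})=\lceil \frac{n-1}{2}\rceil$.
   Context: All graphs are finite and simple. $P_n$ is a path on $n$ vertices, $K_1$ a single vertex, and $P_n+K_1$ is the join (the vertex of $K_1$ is joined to every vertex of $P_n$). $\mathbb{N}_0$ denotes the non-negative integers; for $A,B\subseteq\mathbb{N}_0$, $A+B=\{a+b:a\in A,b\in B\}$. An integer additive set-indexer (IASI) of a graph $G$ is an injective map $f:V(G)\to 2^{\mathbb{N}_0}$ such that $g_f:E(G)\to 2^{\mathbb{N}_0}$, $g_f(uv)=f(u)+f(v)$, is injective. An edge $e$ is mono-indexed if $|g_f(e)|=1$. $f$ is a weak IASI if $|g_f(uv)|=\max(|f(u)|,|f(v)|)$ for every edge $uv$. The sparing number $\varphi(G)$ is the minimum number of mono-indexed edges required for $G$ to admit a weak IASI (minimum over all weak IASIs of $G$). -}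

module Defs where

open import Data.Nat using (ℕ; zero; suc; _≟_; _⊔_)
open import Data.Fin using (Fin; zero; suc)
open import Data.List using (List; []; _∷_; map; _++_; length; lookup; filter; deduplicate; cartesianProductWith; allFin)
open import Data.List.Membership.Propositional using (_∈_)
open import Data.Product using (_×_; _,_; proj₁; proj₂; Σ)
open import Function.Bundles using (_⇔_)
open import Relation.Binary.PropositionalEquality using (_≡_)

-- Finite subsets of ℕ₀, represented by (not necessarily sorted or
-- duplicate-free) lists; set equality is extensional.

FinSet : Set
FinSet = List ℕ

_≈ₛ_ : FinSet → FinSet → Set
A ≈ₛ B = ∀ x → (x ∈ A) ⇔ (x ∈ B)

card : FinSet → ℕ
card A = length (deduplicate _≟_ A)

_⊕_ : FinSet → FinSet → FinSet
A ⊕ B = cartesianProductWith Data.Nat._+_ A B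

-- Finite simple graphs: vertex set Fin nV, edge set given as a list of
-- (unordered, each listed once) pairs of end vertices.

record Graph : Set where
  field
    nV    : ℕ
    edges : List (Fin nV × Fin nV)
open Graph public

pathEdges : (n : ℕ) → List (Fin n × Fin n)
pathEdges zero = []
pathEdges (suc zero) = []
pathEdges (suc (suc k)) =
  (zero , suc zero) ∷ map (λ e → suc (proj₁ e) , suc (proj₂ e)) (pathEdges (suc k))

-- Fan F_{1,n} = P_n + K_1 : vertex 0 is the K_1 vertex (hub),
-- vertex suc i is the i-th vertex of P_n.
fan : ℕ → Graph
fan n = record
  { nV = suc n
  ; edges = map (λ i → zero , suc i) (allFin n)
         ++ map (λ e → suc (proj₁ e) , suc (proj₂ e)) (pathEdges n)
  }

module _ (G : Graph) where

  edgeSet : (Fin (nV G) → FinSet) → Fin (nV G) × Fin (nV G) → FinSet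
  edgeSet f e = f (proj₁ e) ⊕ f (proj₂ e)

  record IsWeakIASI (f : Fin (nV G) → FinSet) : Set where
    field
      vertex-injective : ∀ u v → f u ≈ₛ f v → u ≡ v
      edge-injective   : ∀ (i j : Fin (length (edges G))) →
                         edgeSet f (lookup (edges G) i) ≈ₛ edgeSet f (lookup (edges G) j) → i ≡ j
      weak             : ∀ (i : Fin (length (edges G))) →
                         card (edgeSet f (lookup (edges G) i))
                           ≡ card (f (proj₁ (lookup (edges G) i))) ⊔ card (f (proj₂ (lookup (edges G) i)))

  monoCount : (Fin (nV G) → FinSet) → ℕ
  monoCount f = length (filter (λ e → card (edgeSet f e) ≟ 1) (edges G))

  SparingNumber : ℕ → Set
  SparingNumber k =
    Σ (Fin (nV G) → FinSet) (λ f → IsWeakIASI f × monoCount f ≡ k)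
    × (∀ f → IsWeakIASI f → k Data.Nat.≤ monoCount f)

module Submission where

open import Defs
open import Data.Nat using (ℕ; zero; suc; _≟_; _⊔_; _+_; _≤_; _<_; _∸_; z≤n; s≤s; ⌊_/2⌋; ⌈_/2⌉; _≤?_)
open import Data.Nat.Properties
open import Data.Bool using (Bool; true; false; _∧_; _∨_)
open import Data.Fin using (Fin; zero; suc; inject₁; toℕ)
open import Data.Fin.Properties using (toℕ-inject₁; toℕ-injective; toℕ<n)
open import Data.List using (List; []; _∷_; map; _++_; length; filter; tabulate; lookup; deduplicate; removeAt; [_])
open import Data.List.Properties
  using (length-map; length-++; length-removeAt′; length-tabulate; map-tabulate;
         filter-accept; filter-reject; filter-all; filter-none; filter-++)
open import Data.List.Extrema.Nat using (max; argmax-sel; ⊥≤max; xs≤max)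
open import Data.List.Membership.Propositional using (_∈_)
open import Data.List.Membership.Propositional.Properties
  using (∈-deduplicate⁺; ∈-deduplicate⁻; ∈-cartesianProductWith⁺; ∈-cartesianProductWith⁻; ∈-map⁻;
         ∈-++⁻; ∈-++⁺ˡ; ∈-++⁺ʳ; ∈-tabulate⁺; ∈-tabulate⁻; ∈-lookup)
open import Data.List.Relation.Binary.Subset.Propositional using (_⊆_)
open import Data.List.Relation.Binary.Disjoint.Propositional using (Disjoint)
open import Data.List.Relation.Unary.Any using (here; there; index)
open import Data.List.Relation.Unary.Any.Properties using (lookup-index)
open import Data.List.Relation.Unary.All as All using (All; []; _∷_)
open import Data.List.Relation.Unary.All.Properties using (tabulate⁺)
open import Data.List.Relation.Unary.AllPairs using (AllPairs; []; _∷_)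
import Data.List.Relation.Unary.AllPairs.Properties as AllPairs
open import Data.List.Relation.Unary.Linked as Linked using (Linked; []; [-]; _∷_)
open import Data.List.Relation.Unary.Unique.Propositional using (Unique)
import Data.List.Relation.Unary.Unique.Propositional.Properties as Unique
open import Data.List.Relation.Unary.Unique.DecPropositional.Properties _≟_ using (deduplicate-!)
open import Data.Product using (_×_; _,_; proj₁; proj₂; Σ-syntax)
open import Data.Sum using (_⊎_; inj₁; inj₂)
open import Data.Empty using (⊥; ⊥-elim)
open import Function using (id)
open import Function.Bundles using (Equivalence; mk⇔)
open import Relation.Nullary using (¬_; ¬?; Dec; yes; no; does)
open import Relation.Unary using (Decidable)
open import Relation.Binary.Definitions using (tri<; tri≈; tri>)
open import Relation.Binary.PropositionalEquality hiding ([_])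

-- If |A|, |B| ≥ 2 then |A + B| > max(|A|, |B|): for b < b' in
-- B the sums a + b (a ∈ A) are distinct and max A + b' exceeds them all.
-- Hence in a weak IASI no edge joins two "big" vertices (labels with ≥ 2
-- elements), every label is nonempty (an empty label would empty its
-- neighbour's too, breaking injectivity), and so an edge between two small
-- vertices is mono-indexed.  Write n = m + 1.  If the hub is big, its
-- neighbours are all small and all m rim edges are mono-indexed.  If the hub
-- is small, a spoke to a small vertex is mono-indexed, and since big path
-- vertices are pairwise non-adjacent at least ⌊ (m + 1) / 2 ⌋ = ⌈ m / 2 ⌉
-- spokes are.
--
-- Label the hub {0} and the j-th path vertex by an interval
-- {x_j} or {x_j, x_j + 1}, two-element exactly for even j, with x_j = n + j + 1.
-- Sums of such intervals are intervals, each rim edge has a wide endpoint, and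
-- edges are told apart by the least elements of their sumsets, which increase
-- along the edge list; only the ⌊ n / 2 ⌋ spokes to odd j are mono-indexed.

∈-removeAt : {A : Set} {x z : A} {ys : List A} (p : x ∈ ys) →
             z ∈ ys → z ≢ x → z ∈ removeAt ys (index p)
∈-removeAt (here refl) (here refl) z≢x = ⊥-elim (z≢x refl)
∈-removeAt (here refl) (there z∈)  _   = z∈
∈-removeAt (there p)   (here z≡y)  _   = here z≡y
∈-removeAt (there p)   (there z∈)  z≢x = there (∈-removeAt p z∈ z≢x)

unique-⊆-length : {A : Set} {xs ys : List A} → Unique xs → xs ⊆ ys → length xs ≤ length ys
unique-⊆-length {xs = []}     _             _   = z≤n
unique-⊆-length {xs = x ∷ xs} {ys} (x∉xs ∷ u) xs⊆ys =
  subst (suc (length xs) ≤_) (sym (length-removeAt′ ys (index x∈ys)))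
        (s≤s (unique-⊆-length u rest⊆))
  where
  x∈ys : x ∈ ys
  x∈ys = xs⊆ys (here refl)
  rest⊆ : xs ⊆ removeAt ys (index x∈ys)
  rest⊆ z∈xs = ∈-removeAt x∈ys (xs⊆ys (there z∈xs)) (λ z≡x → All.lookup x∉xs z∈xs (sym z≡x))

unique-⊆-card : {xs : List ℕ} (A : FinSet) → Unique xs → xs ⊆ A → length xs ≤ card A
unique-⊆-card A u xs⊆A = unique-⊆-length u (λ z∈ → ∈-deduplicate⁺ _≟_ (xs⊆A z∈))

card-mono : (A B : FinSet) → A ⊆ B → card A ≤ card B
card-mono A B A⊆B = unique-⊆-card B (deduplicate-! A) (λ z∈ → A⊆B (∈-deduplicate⁻ _≟_ A z∈))

card≡0 : (A : FinSet) → card A ≡ 0 → A ≡ []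
card≡0 []      _ = refl
card≡0 (_ ∷ _) ()

≡⇒≈ₛ : {A B : FinSet} → A ≡ B → A ≈ₛ B
≡⇒≈ₛ refl x = mk⇔ (λ x∈ → x∈) (λ x∈ → x∈)

nonempty-card : (A : FinSet) → A ≢ [] → 1 ≤ card A
nonempty-card []      A≢[] = ⊥-elim (A≢[] refl)
nonempty-card (_ ∷ _) _    = s≤s z≤n

⊕-comm-⊆ : (A B : FinSet) → B ⊕ A ⊆ A ⊕ B
⊕-comm-⊆ A B z∈ with ∈-cartesianProductWith⁻ _+_ B A z∈
... | b , a , b∈B , a∈A , refl = subst (_∈ A ⊕ B) (+-comm a b) (∈-cartesianProductWith⁺ _+_ a∈A b∈B)

⊕-[] : (A : FinSet) → A ⊕ [] ≡ []
⊕-[] []      = refl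
⊕-[] (_ ∷ A) = ⊕-[] A

two-elements : (B : FinSet) → 2 ≤ card B → Σ[ b ∈ ℕ ] Σ[ b' ∈ ℕ ] b ∈ B × b' ∈ B × b < b'
two-elements B 2≤|B| = pick (deduplicate _≟_ B) (deduplicate-! B) 2≤|B| (∈-deduplicate⁻ _≟_ B)
  where
  pick : (D : List ℕ) → Unique D → 2 ≤ length D → D ⊆ B →
         Σ[ b ∈ ℕ ] Σ[ b' ∈ ℕ ] b ∈ B × b' ∈ B × b < b'
  pick (x ∷ []) _ (s≤s ()) _
  pick (x ∷ y ∷ _) ((x≢y ∷ _) ∷ _) _ D⊆B with <-cmp x y
  ... | tri< x<y _ _ = x , y , D⊆B (here refl) , D⊆B (there (here refl)) , x<y
  ... | tri≈ _ x≡y _ = ⊥-elim (x≢y x≡y)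
  ... | tri> _ _ y<x = y , x , D⊆B (there (here refl)) , D⊆B (here refl) , y<x

max-∈ : (d : ℕ) (ds : List ℕ) → max d ds ∈ d ∷ ds
max-∈ d ds with argmax-sel (λ x → x) d ds
... | inj₁ M≡d = here M≡d
... | inj₂ M∈ds = there M∈ds

max-bound : (d : ℕ) (ds : List ℕ) → ∀ {x} → x ∈ d ∷ ds → x ≤ max d ds
max-bound d ds (here refl) = ⊥≤max d ds
max-bound d ds (there x∈) = All.lookup (xs≤max d ds) x∈

-- Key estimate: adding a set with two elements b < b' to a nonempty A
-- produces more than |A| sums, namely the distinct sums a + b (a ∈ A)
-- together with max A + b', which exceeds all of them.
card-⊕-grows : (A B : FinSet) → 1 ≤ card A → 2 ≤ card B → card A < card (A ⊕ B)
card-⊕-grows A B 1≤|A| 2≤|B|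
  with deduplicate _≟_ A | deduplicate-! A | ∈-deduplicate⁻ _≟_ A | two-elements B 2≤|B|
... | d ∷ ds | uD | D⊆A | b , b' , b∈B , b'∈B , b<b' =
  subst (_≤ card (A ⊕ B)) length-sums (unique-⊆-card (A ⊕ B) sumsUnique sums⊆)
  where
  D : List ℕ
  D = d ∷ ds
  M : ℕ
  M = max d ds
  shifted : List ℕ
  shifted = map (_+ b) D
  sums : List ℕ
  sums = shifted ++ [ M + b' ]
  length-sums : length sums ≡ suc (length D)
  length-sums = begin
    length sums                 ≡⟨ length-++ shifted ⟩
    length shifted + 1          ≡⟨ cong (_+ 1) (length-map (_+ b) D) ⟩
    length D + 1                ≡⟨ +-comm (length D) 1 ⟩
    suc (length D)              ∎
    where open ≡-Reasoning
  top-new : Disjoint shifted [ M + b' ]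
  top-new (v∈ , here refl) with ∈-map⁻ (_+ b) v∈
  ... | a , a∈D , v≡a+b =
    <-irrefl (sym v≡a+b) (≤-<-trans (+-monoˡ-≤ b (max-bound d ds a∈D)) (+-monoʳ-< M b<b'))
  sumsUnique : Unique sums
  sumsUnique = Unique.++⁺ (Unique.map⁺ (+-cancelʳ-≡ _ _ _) uD) ([] ∷ []) top-new
  sums⊆ : sums ⊆ A ⊕ B
  sums⊆ z∈ with ∈-++⁻ shifted z∈
  ... | inj₁ z∈shifted with ∈-map⁻ (_+ b) z∈shifted
  ...   | a , a∈D , refl = ∈-cartesianProductWith⁺ _+_ (D⊆A a∈D) b∈B
  sums⊆ z∈ | inj₂ (here refl) = ∈-cartesianProductWith⁺ _+_ (D⊆A (max-∈ d ds)) b'∈B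

card-⊕-exceeds-max : (A B : FinSet) → 2 ≤ card A → 2 ≤ card B → card A ⊔ card B < card (A ⊕ B)
card-⊕-exceeds-max A B 2≤|A| 2≤|B| =
  ⊔-lub (card-⊕-grows A B (≤-trans (s≤s z≤n) 2≤|A|) 2≤|B|)
        (≤-trans (card-⊕-grows B A (≤-trans (s≤s z≤n) 2≤|B|) 2≤|A|) (card-mono (B ⊕ A) (A ⊕ B) (⊕-comm-⊆ A B)))

WeakSum : FinSet → FinSet → Set
WeakSum A B = card (A ⊕ B) ≡ card A ⊔ card B

weak-not-both-big : (A B : FinSet) → WeakSum A B → ¬ (2 ≤ card A × 2 ≤ card B)
weak-not-both-big A B weak (2≤|A| , 2≤|B|) =
  <-irrefl (sym weak) (card-⊕-exceeds-max A B 2≤|A| 2≤|B|)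

weak-empty : (A B : FinSet) → WeakSum A B → A ≡ [] ⊎ B ≡ [] → A ≡ [] × B ≡ []
weak-empty .[] B weak (inj₁ refl) = refl , card≡0 B (sym weak)
weak-empty A .[] weak (inj₂ refl) = card≡0 A |A|≡0 , refl
  where
  |A|≡0 : card A ≡ 0
  |A|≡0 = begin
    card A            ≡⟨ sym (⊔-identityʳ (card A)) ⟩
    card A ⊔ 0        ≡⟨ sym weak ⟩
    card (A ⊕ [])     ≡⟨ cong card (⊕-[] A) ⟩
    0                 ∎
    where open ≡-Reasoning

module WeakIASIFacts (G : Graph) (f : Fin (nV G) → FinSet) (w : IsWeakIASI G f) where
  open IsWeakIASI w

  weak-at : ∀ {u v} → (u , v) ∈ edges G → WeakSum (f u) (f v)
  weak-at e∈E = subst (λ e → WeakSum (f (proj₁ e)) (f (proj₂ e))) (sym (lookup-index e∈E)) (weak (index e∈E))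

  -- The endpoints of a non-loop edge carry nonempty labels: an empty label
  -- would force both labels to be empty, contradicting injectivity.
  endpoint-nonempty : ∀ {u v} → (u , v) ∈ edges G → u ≢ v → f u ≡ [] ⊎ f v ≡ [] → ⊥
  endpoint-nonempty e∈E u≢v empty with weak-empty _ _ (weak-at e∈E) empty
  ... | fu≡[] , fv≡[] = u≢v (vertex-injective _ _ (≡⇒≈ₛ (trans fu≡[] (sym fv≡[]))))

even : ℕ → Bool
even zero          = true
even (suc zero)    = false
even (suc (suc n)) = even n

module Counting {A : Set} {P : A → Set} (P? : Decidable P) where

  count : List A → ℕ
  count xs = length (filter P? xs)

  count-accept : ∀ {x} xs → P x → count (x ∷ xs) ≡ suc (count xs)
  count-accept xs px = cong length (filter-accept P? px)

  count-reject : ∀ {x} xs → ¬ P x → count (x ∷ xs) ≡ count xs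
  count-reject xs ¬px = cong length (filter-reject P? ¬px)

  count-cons : ∀ x xs → count xs ≤ count (x ∷ xs)
  count-cons x xs with does (P? x)
  ... | true  = n≤1+n (count xs)
  ... | false = ≤-refl

  module _ {Big : A → Set} (Big? : Decidable Big) where
    open ≤-Reasoning

    half-small : ∀ xs → All (λ x → ¬ Big x → P x) xs → Linked (λ x y → ¬ (Big x × Big y)) xs →
                 ⌊ length xs /2⌋ ≤ count xs
    half-small []       _ _ = z≤n
    half-small (x ∷ ys) small⇒P linked with Big? x
    half-small (x ∷ ys) (x-small⇒P ∷ small⇒P) linked | no ¬big-x = begin
      ⌊ suc (length ys) /2⌋          ≤⟨ ⌊n/2⌋-mono (n≤1+n (suc (length ys))) ⟩
      suc ⌊ length ys /2⌋            ≤⟨ s≤s (half-small ys small⇒P (Linked.tail linked)) ⟩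
      suc (count ys)                 ≡⟨ count-accept ys (x-small⇒P ¬big-x) ⟨
      count (x ∷ ys)                 ∎
    half-small (x ∷ []) _ _ | yes big-x = z≤n
    half-small (x ∷ y ∷ xs) (_ ∷ y-small⇒P ∷ small⇒P) (notBoth ∷ linked) | yes big-x = begin
      suc ⌊ length xs /2⌋            ≤⟨ s≤s (half-small xs small⇒P (Linked.tail linked)) ⟩
      suc (count xs)                 ≡⟨ count-accept xs (y-small⇒P (λ big-y → notBoth (big-x , big-y))) ⟨
      count (y ∷ xs)                 ≤⟨ count-cons x (y ∷ xs) ⟩
      count (x ∷ y ∷ xs)             ∎

  count-odd-positions : ∀ n (g : Fin n → A) →
    (∀ j → even (toℕ j) ≡ false → P (g j)) → (∀ j → even (toℕ j) ≡ true → ¬ P (g j)) →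
    count (tabulate g) ≡ ⌊ n /2⌋
  count-odd-positions zero          g odd⇒P even⇒¬P = refl
  count-odd-positions (suc zero)    g odd⇒P even⇒¬P = count-reject [] (even⇒¬P zero refl)
  count-odd-positions (suc (suc n)) g odd⇒P even⇒¬P = begin
    count (g₀ ∷ g₁ ∷ tabulate g₂₊)   ≡⟨ count-reject (g₁ ∷ tabulate g₂₊) (even⇒¬P zero refl) ⟩
    count (g₁ ∷ tabulate g₂₊)        ≡⟨ count-accept (tabulate g₂₊) (odd⇒P (suc zero) refl) ⟩
    suc (count (tabulate g₂₊))       ≡⟨ cong suc (count-odd-positions n g₂₊ (λ j → odd⇒P (suc (suc j)))
                                                                             (λ j → even⇒¬P (suc (suc j)))) ⟩
    suc ⌊ n /2⌋                      ∎
    where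
    open ≡-Reasoning
    g₀ g₁ : A
    g₀ = g zero
    g₁ = g (suc zero)
    g₂₊ : Fin n → A
    g₂₊ j = g (suc (suc j))

linked-tabulate : {A : Set} {R : A → A → Set} → ∀ {n} (g : Fin (suc n) → A) →
                  (∀ k → R (g (inject₁ k)) (g (suc k))) → Linked R (tabulate g)
linked-tabulate {n = zero}  g consecutive = [-]
linked-tabulate {n = suc n} g consecutive =
  consecutive zero ∷ linked-tabulate (λ j → g (suc j)) (λ k → consecutive (suc k))

spoke : ∀ {n} → Fin n → Fin (suc n) × Fin (suc n)
spoke j = zero , suc j

rim : ∀ {m} → Fin m → Fin (suc (suc m)) × Fin (suc (suc m))
rim k = suc (inject₁ k) , suc (suc k)

pathEdges-tabulate : ∀ m → pathEdges (suc m) ≡ tabulate (λ (k : Fin m) → inject₁ k , suc k)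
pathEdges-tabulate zero    = refl
pathEdges-tabulate (suc m) =
  cong ((zero , suc zero) ∷_) (trans (cong (map _) (pathEdges-tabulate m)) (map-tabulate _ _))

fan-edges : ∀ m → edges (fan (suc m)) ≡ tabulate spoke ++ tabulate rim
fan-edges m =
  cong₂ _++_ (map-tabulate id spoke) (trans (cong (map _) (pathEdges-tabulate m)) (map-tabulate _ _))

module Fan (m : ℕ) where
  N : ℕ
  N = suc m

  G : Graph
  G = fan N

  V : Set
  V = Fin (suc N)

  E : List (V × V)
  E = edges G

  spokes : List (V × V)
  spokes = tabulate spoke

  rims : List (V × V)
  rims = tabulate rim

  spoke∈E : ∀ j → spoke j ∈ E
  spoke∈E j = subst (spoke j ∈_) (sym (fan-edges m)) (∈-++⁺ˡ (∈-tabulate⁺ {f = spoke} j))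

  rim∈E : ∀ k → rim k ∈ E
  rim∈E k = subst (rim k ∈_) (sym (fan-edges m)) (∈-++⁺ʳ spokes (∈-tabulate⁺ {f = rim} k))

  edge-cases : ∀ {e} → e ∈ E → (Σ[ j ∈ Fin N ] e ≡ spoke j) ⊎ (Σ[ k ∈ Fin m ] e ≡ rim k)
  edge-cases {e} e∈E with ∈-++⁻ spokes (subst (e ∈_) (fan-edges m) e∈E)
  ... | inj₁ e∈spokes = inj₁ (∈-tabulate⁻ e∈spokes)
  ... | inj₂ e∈rims   = inj₂ (∈-tabulate⁻ e∈rims)

  module MonoCount (f : V → FinSet) where
    mono? : Decidable (λ e → card (edgeSet G f e) ≡ 1)
    mono? e = card (edgeSet G f e) ≟ 1

    open Counting mono? public

    monoCount-split : monoCount G f ≡ count spokes + count rims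
    monoCount-split = begin
      monoCount G f                     ≡⟨ cong count (fan-edges m) ⟩
      count (spokes ++ rims)            ≡⟨ cong length (filter-++ mono? spokes rims) ⟩
      length (filter mono? spokes ++ filter mono? rims) ≡⟨ length-++ (filter mono? spokes) ⟩
      count spokes + count rims         ∎
      where open ≡-Reasoning

module LowerBound (m : ℕ) (f : Fin (suc (suc m)) → FinSet) (w : IsWeakIASI (fan (suc m)) f) where
  open Fan m
  open MonoCount f
  open WeakIASIFacts G f w

  Big : V → Set
  Big v = 2 ≤ card (f v)

  -- Every vertex lies on a spoke, so its label is nonempty.
  label-nonempty : ∀ v → 1 ≤ card (f v)
  label-nonempty zero    = nonempty-card (f zero) (λ e → endpoint-nonempty (spoke∈E zero) (λ ()) (inj₁ e))
  label-nonempty (suc j) = nonempty-card (f (suc j)) (λ e → endpoint-nonempty (spoke∈E j) (λ ()) (inj₂ e))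

  small-singleton : ∀ v → ¬ Big v → card (f v) ≡ 1
  small-singleton v ¬big = ≤-antisym (≤-pred (≰⇒> ¬big)) (label-nonempty v)

  small-edge-mono : ∀ {u v} → (u , v) ∈ E → ¬ Big u → ¬ Big v → card (f u ⊕ f v) ≡ 1
  small-edge-mono {u} {v} e∈E ¬big-u ¬big-v =
    trans (weak-at e∈E) (cong₂ _⊔_ (small-singleton u ¬big-u) (small-singleton v ¬big-v))

  not-both-big : ∀ {u v} → (u , v) ∈ E → ¬ (Big u × Big v)
  not-both-big {u} {v} e∈E = weak-not-both-big (f u) (f v) (weak-at e∈E)

  -- Big hub: every rim edge joins two small vertices, so all m rims are mono-indexed.
  big-hub : Big zero → ⌈ m /2⌉ ≤ count rims
  big-hub hub-big = begin
    ⌈ m /2⌉                 ≤⟨ ⌈n/2⌉≤n m ⟩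
    m                       ≡⟨ length-tabulate rim ⟨
    length rims             ≡⟨ cong length (filter-all mono? (tabulate⁺ rim-mono)) ⟨
    count rims              ∎
    where
    open ≤-Reasoning
    small-tip : ∀ j → ¬ Big (suc j)
    small-tip j big-tip = not-both-big (spoke∈E j) (hub-big , big-tip)
    rim-mono : ∀ k → card (edgeSet G f (rim k)) ≡ 1
    rim-mono k = small-edge-mono (rim∈E k) (small-tip (inject₁ k)) (small-tip (suc k))

  -- Small hub: spokes to small vertices are mono-indexed, and big path vertices
  -- are never adjacent, so at least half of the m + 1 spokes are mono-indexed.
  small-hub : ¬ Big zero → ⌈ m /2⌉ ≤ count spokes
  small-hub ¬big-hub =
    subst (λ l → ⌊ l /2⌋ ≤ count spokes) (length-tabulate spoke)
      (half-small (λ e → 2 ≤? card (f (proj₂ e))) spokes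
        (tabulate⁺ (λ j → small-edge-mono (spoke∈E j) ¬big-hub))
        (linked-tabulate spoke (λ k → not-both-big (rim∈E k))))

  lower-bound : ⌈ m /2⌉ ≤ monoCount G f
  lower-bound = subst (⌈ m /2⌉ ≤_) (sym monoCount-split) (by-hub (2 ≤? card (f zero)))
    where
    by-hub : Dec (Big zero) → ⌈ m /2⌉ ≤ count spokes + count rims
    by-hub (yes big) = ≤-trans (big-hub big) (m≤n+m (count rims) (count spokes))
    by-hub (no ¬big) = ≤-trans (small-hub ¬big) (m≤m+n (count spokes) (count rims))

sorted-lookup-injective : {A : Set} (κ : A → ℕ) {xs : List A} → AllPairs (λ x y → κ x < κ y) xs →
                          ∀ i j → κ (lookup xs i) ≡ κ (lookup xs j) → i ≡ j
sorted-lookup-injective κ (_ ∷ _)           zero    zero    _ = refl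
sorted-lookup-injective κ (x<rest ∷ _)      zero    (suc j) e = ⊥-elim (<-irrefl e (All.lookup x<rest (∈-lookup j)))
sorted-lookup-injective κ (x<rest ∷ _)      (suc i) zero    e = ⊥-elim (<-irrefl (sym e) (All.lookup x<rest (∈-lookup i)))
sorted-lookup-injective κ (_ ∷ sorted)      (suc i) (suc j) e = cong suc (sorted-lookup-injective κ sorted i j e)

seg : ℕ → Bool → FinSet
seg x false = x ∷ []
seg x true  = x ∷ suc x ∷ []

width : Bool → ℕ
width false = 1
width true  = 2

card-seg : ∀ x b → card (seg x b) ≡ width b
card-seg x false = refl
card-seg x true  =
  cong (λ l → suc (length l)) (filter-accept (λ y → ¬? (x ≟ y)) (λ x≡1+x → 1+n≢n (sym x≡1+x)))

width-∨ : ∀ b b' → width (b ∨ b') ≡ width b ⊔ width b'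
width-∨ false false = refl
width-∨ false true  = refl
width-∨ true  false = refl
width-∨ true  true  = refl

seg-⊕ : ∀ x y b b' → b ∧ b' ≡ false → seg x b ⊕ seg y b' ≡ seg (x + y) (b ∨ b')
seg-⊕ x y false false _ = refl
seg-⊕ x y true  false _ = refl
seg-⊕ x y false true  _ = cong (λ z → x + y ∷ z ∷ []) (+-suc x y)
seg-⊕ x y true  true  ()

seg-min : ∀ x b → x ∈ seg x b
seg-min x false = here refl
seg-min x true  = here refl

seg-∈ : ∀ {z} y b → z ∈ seg y b → z ≡ y ⊎ z ≡ suc y
seg-∈ y false (here z≡y)         = inj₁ z≡y
seg-∈ y true  (here z≡y)         = inj₁ z≡y
seg-∈ y true  (there (here z≡y)) = inj₂ z≡y

seg-≈ : ∀ x y b b' → seg x b ≈ₛ seg y b' → x ≡ y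
seg-≈ x y b b' eq = least (seg-∈ y b' (Equivalence.to (eq x) (seg-min x b)))
                          (seg-∈ x b (Equivalence.from (eq y) (seg-min y b')))
  where
  least : x ≡ y ⊎ x ≡ suc y → y ≡ x ⊎ y ≡ suc x → x ≡ y
  least (inj₁ x≡y) _          = x≡y
  least (inj₂ _)   (inj₁ y≡x) = sym y≡x
  least (inj₂ refl) (inj₂ y≡2+y) = ⊥-elim (<-irrefl y≡2+y (≤-trans (n<1+n y) (n≤1+n (suc y))))

even-∧-suc : ∀ n → even n ∧ even (suc n) ≡ false
even-∧-suc zero          = refl
even-∧-suc (suc zero)    = refl
even-∧-suc (suc (suc n)) = even-∧-suc n

even-∨-suc : ∀ n → even n ∨ even (suc n) ≡ true
even-∨-suc zero          = refl
even-∨-suc (suc zero)    = refl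
even-∨-suc (suc (suc n)) = even-∨-suc n

module Construction (m : ℕ) where
  open Fan m

  key : V → ℕ
  key zero    = 0
  key (suc j) = suc (N + toℕ j)

  wide : V → Bool
  wide zero    = false
  wide (suc j) = even (toℕ j)

  label : V → FinSet
  label v = seg (key v) (wide v)

  -- The least element of the sumset of an edge.
  edgeKey : V × V → ℕ
  edgeKey e = key (proj₁ e) + key (proj₂ e)

  key-injective : ∀ u v → key u ≡ key v → u ≡ v
  key-injective zero    zero    _ = refl
  key-injective (suc i) (suc j) e =
    cong suc (toℕ-injective (+-cancelˡ-≡ N (toℕ i) (toℕ j) (suc-injective e)))

  rim-wide : ∀ k → wide (proj₁ (rim k)) ≡ even (toℕ k) × wide (proj₂ (rim k)) ≡ even (suc (toℕ k))
  rim-wide k = cong even (toℕ-inject₁ k) , refl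

  -- No edge joins two wide vertices, so every edge label is again an interval.
  not-both-wide : ∀ {e} → e ∈ E → wide (proj₁ e) ∧ wide (proj₂ e) ≡ false
  not-both-wide e∈E with edge-cases e∈E
  ... | inj₁ (j , refl) = refl
  ... | inj₂ (k , refl) with rim-wide k
  ...   | w₁ , w₂ = trans (cong₂ _∧_ w₁ w₂) (even-∧-suc (toℕ k))

  edge-label : ∀ {e} → e ∈ E → edgeSet G label e ≡ seg (edgeKey e) (wide (proj₁ e) ∨ wide (proj₂ e))
  edge-label {u , v} e∈E = seg-⊕ (key u) (key v) (wide u) (wide v) (not-both-wide e∈E)

  card-edge : ∀ {e} → e ∈ E → card (edgeSet G label e) ≡ width (wide (proj₁ e) ∨ wide (proj₂ e))
  card-edge {e} e∈E = trans (cong card (edge-label e∈E)) (card-seg (edgeKey e) _)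

  label-weak : ∀ {u v} → (u , v) ∈ E → card (edgeSet G label (u , v)) ≡ card (label u) ⊔ card (label v)
  label-weak {u} {v} e∈E = begin
    card (edgeSet G label (u , v))      ≡⟨ card-edge e∈E ⟩
    width (wide u ∨ wide v)             ≡⟨ width-∨ (wide u) (wide v) ⟩
    width (wide u) ⊔ width (wide v)     ≡⟨ cong₂ _⊔_ (card-seg (key u) (wide u)) (card-seg (key v) (wide v)) ⟨
    card (label u) ⊔ card (label v)     ∎
    where open ≡-Reasoning

  -- Edge keys increase strictly along the edge list: spokes have keys in
  -- (N, 2N], rims have keys above 2N + 2.
  rim-key : ∀ k → edgeKey (rim k) ≡ suc (N + toℕ k) + suc (N + suc (toℕ k))
  rim-key k = cong (λ i → suc (N + i) + suc (N + suc (toℕ k))) (toℕ-inject₁ k)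

  spoke-below-rim : ∀ j k → edgeKey (spoke j) < edgeKey (rim k)
  spoke-below-rim j k = begin-strict
    suc (N + toℕ j)                      <⟨ s≤s (+-monoʳ-< N (toℕ<n j)) ⟩
    suc (N + N)                          ≤⟨ s≤s (+-monoʳ-≤ N (n≤1+n N)) ⟩
    suc N + suc N                        ≤⟨ +-mono-≤ (s≤s (m≤m+n N (toℕ k))) (s≤s (m≤m+n N (suc (toℕ k)))) ⟩
    suc (N + toℕ k) + suc (N + suc (toℕ k)) ≡⟨ rim-key k ⟨
    edgeKey (rim k)                      ∎
    where open ≤-Reasoning

  edges-sorted : AllPairs (λ e e' → edgeKey e < edgeKey e') E
  edges-sorted = subst (AllPairs _) (sym (fan-edges m))
    (AllPairs.++⁺ (AllPairs.tabulate⁺-< {f = spoke} spokes-increase)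
                  (AllPairs.tabulate⁺-< {f = rim} rims-increase)
                  (tabulate⁺ {f = spoke} (λ j → tabulate⁺ {f = rim} (spoke-below-rim j))))
    where
    spokes-increase : ∀ {i j} → toℕ i < toℕ j → edgeKey (spoke i) < edgeKey (spoke j)
    spokes-increase i<j = s≤s (+-monoʳ-< N i<j)
    rims-increase : ∀ {k l} → toℕ k < toℕ l → edgeKey (rim k) < edgeKey (rim l)
    rims-increase {k} {l} k<l = subst₂ _<_ (sym (rim-key k)) (sym (rim-key l))
      (+-mono-< (s≤s (+-monoʳ-< N k<l)) (s≤s (+-monoʳ-< N (s≤s k<l))))

  is-weak-IASI : IsWeakIASI G label
  is-weak-IASI = record
    { vertex-injective = λ u v eq → key-injective u v (seg-≈ (key u) (key v) (wide u) (wide v) eq)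
    ; edge-injective   = λ i j eq → sorted-lookup-injective edgeKey edges-sorted i j
        (seg-≈ _ _ _ _ (subst₂ _≈ₛ_ (edge-label (∈-lookup i)) (edge-label (∈-lookup j)) eq))
    ; weak             = λ i → label-weak (∈-lookup i)
    }

  open MonoCount label

  spoke-card : ∀ j → card (edgeSet G label (spoke j)) ≡ width (even (toℕ j))
  spoke-card j = card-edge (spoke∈E j)

  mono-spokes : count spokes ≡ ⌊ N /2⌋
  mono-spokes = count-odd-positions N spoke
    (λ j odd → trans (spoke-card j) (cong width odd))
    (λ j ev mono → 1+n≢n (trans (sym (trans (spoke-card j) (cong width ev))) mono))

  rim-card : ∀ k → card (edgeSet G label (rim k)) ≡ 2
  rim-card k with rim-wide k
  ... | w₁ , w₂ = trans (card-edge (rim∈E k)) (cong width (trans (cong₂ _∨_ w₁ w₂) (even-∨-suc (toℕ k))))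

  mono-rims : count rims ≡ 0
  mono-rims = cong length (filter-none mono? (tabulate⁺ {f = rim} λ k mono → 1+n≢n (trans (sym (rim-card k)) mono)))

  mono-count : monoCount G label ≡ ⌈ m /2⌉
  mono-count = begin
    monoCount G label           ≡⟨ monoCount-split ⟩
    count spokes + count rims   ≡⟨ cong₂ _+_ mono-spokes mono-rims ⟩
    ⌊ N /2⌋ + 0                 ≡⟨ +-identityʳ ⌊ N /2⌋ ⟩
    ⌈ m /2⌉                     ∎
    where open ≡-Reasoning

mainTheorem13 : (n : ℕ) → 1 ≤ n → SparingNumber (fan n) ⌈ n ∸ 1 /2⌉
mainTheorem13 (suc m) _ =
  (label , is-weak-IASI , mono-count) , λ f w → LowerBound.lower-bound m f w
  where open Construction m
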